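{- There is $d_0$ such that the following holds for all $d\geq d_0$. Let $G$ be a graph on $n$ vertices with average degree $d$. Then there exists a non-empty bipartite subgraph $G''$ of $G$ with parts $X$ and $Y$ such that for every $x\in X$, $d_{G''}(x)\geq \frac{\Delta(G'')}{160}$, and for every $y\in Y$, $d_{G''}(y)\geq \frac{d}{20\log n}$.
   Context: Logarithms are base 2. $d_{G''}(v)$ is the degree of $v$ in $G''$ and $\Delta(G'')$ the maximum degree of $G''$. -}

module Defs where

open import Data.Nat using (ℕ; _+_; _⊔_)
open import Data.Fin using (Fin)
open import Data.Bool using (Bool; true; false; if_then_else_)
open import Data.List using (List; map; foldr)
open import Data.Nat.ListAction using (sum)
open import Data.List.Base using (allFin)
open import Relation.Binary.PropositionalEquality using (_≡_)
open import Data.Product using (_×_)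
open import Data.Sum using (_⊎_)
open import Relation.Nullary using (¬_)

record SimpleGraph (n : ℕ) : Set where
  field
    adj   : Fin n → Fin n → Bool
    sym   : ∀ i j → adj i j ≡ adj j i
    irrfl : ∀ i → adj i i ≡ false
open SimpleGraph public

degree : {n : ℕ} → (Fin n → Fin n → Bool) → Fin n → ℕ
degree {n} a v = sum (map (λ u → if a v u then 1 else 0) (allFin n))

-- Sum of all degrees (= 2|E|); the average degree is degSum / n.
degSum : {n : ℕ} → (Fin n → Fin n → Bool) → ℕ
degSum {n} a = sum (map (degree a) (allFin n))

-- Maximum degree (0 for the empty vertex set).
maxDegree : {n : ℕ} → (Fin n → Fin n → Bool) → ℕ
maxDegree {n} a = foldr _⊔_ 0 (map (degree a) (allFin n))

-- The vertex set of G'' is X ∪ Y.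
record BipartiteSubgraph {n : ℕ} (G : SimpleGraph n) : Set where
  field
    X Y      : Fin n → Bool
    disjoint : ∀ v → X v ≡ true → Y v ≡ false
    edges    : Fin n → Fin n → Bool
    e-sym    : ∀ i j → edges i j ≡ edges j i
    e-sub    : ∀ i j → edges i j ≡ true → adj G i j ≡ true
    e-bip    : ∀ i j → edges i j ≡ true →
               (X i ≡ true × Y j ≡ true) ⊎ (Y i ≡ true × X j ≡ true)

-- Sort the vertices into degree classes cls v = ⌊log₂ deg v⌋ ≤ ⌊log₂ n⌋ and
-- orient every edge downwards in the order (class, index), so that the
-- degree sum D is twice the number of downward edges.  Inside each class a
-- greedy cut puts at least half of every vertex's earlier same-class
-- neighbours on the opposite side.  For an option (i , s) let X be class i on
-- side s and Y the lower classes together with the other side of class i.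
-- At least half of the downward edges at v then end in the Y of the option
-- (cls v , side v), whose X contains v, so e(X , Y) summed over all options is
-- at least D / 4.  With K = 20 n ⌊log₂ n⌋, the costs a_i |X| + b |Y| with
-- a_i = 2^(i+1) K and b = 160 D sum over all options to less than 160 K D / 4,
-- so some option has 160 K e(X , Y) > a_i |X| + b |Y|.  Deleting vertices of
-- X with fewer than 2^(i+1) / 160 neighbours in Y and of Y with fewer than
-- D / K neighbours in X preserves this inequality, so it ends in a non-empty
-- bipartite core: all its degrees are below 2^(i+1), those in X are at least
-- 2^(i+1) / 160, and those in Y are at least D / K = d / (20 log₂ n).
module Submission where

open import Data.Bool using (Bool; true; false; if_then_else_; _∧_; _∨_; not; _xor_; T)
import Data.Bool.Properties as Bool
open import Data.Fin as Fin using (Fin; zero; suc; toℕ; punchIn)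
open import Data.Fin.Properties using (punchInᵢ≢i; any?; toℕ-injective; ¬∀⟶∃¬)
open import Data.List using (map)
open import Data.List.Base using (allFin; tabulate)
open import Data.List.Properties using (map-tabulate; foldr-preservesᵇ)
import Data.List.Relation.Unary.All.Properties as All
open import Data.Nat
open import Data.Nat.Induction using (<-wellFounded)
import Data.Nat.ListAction as List
open import Data.Nat.Properties
open import Algebra.Properties.CommutativeSemigroup +-commutativeSemigroup using (xy∙z≈xz∙y; xy∙z≈zy∙x; interchange)
open import Algebra.Properties.CommutativeSemigroup *-commutativeSemigroup using (x∙yz≈y∙xz; xy∙z≈y∙xz)
open import Algebra.Properties.Semiring.Sum +-*-semiring
  using (sum; sum-syntax; ∑-distrib-+; ∑-comm; *-distribˡ-sum; sum-cong-≗; sum-remove)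
open import Data.Nat.Solver using (module +-*-Solver)
open +-*-Solver using (solve; _:+_; _:*_; _:=_; con)
open import Data.Product using (Σ; ∃; ∃₂; _×_; _,_; proj₁; proj₂)
open import Data.Sum using (_⊎_; inj₁; inj₂)
open import Function using (_∘_; id)
open import Induction.WellFounded using (Acc; acc)
open import Relation.Binary using (tri<; tri≈; tri>)
open import Relation.Binary.PropositionalEquality
open import Relation.Nullary using (¬_; Dec; does; yes; no; contradiction)
open import Relation.Nullary.Decidable using (_×-dec_; dec-true; dec-false)

open import Defs hiding (sym)

ι : Bool → ℕ
ι b = if b then 1 else 0

ι-∧ : ∀ a b → ι (a ∧ b) ≡ ι a * ι b
ι-∧ true  b = sym (+-identityʳ (ι b))
ι-∧ false b = refl

ι-∧-swap : ∀ a b → ι (a ∧ b) ≡ ι b * ι a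
ι-∧-swap a b = trans (ι-∧ a b) (*-comm (ι a) (ι b))

ι≤1 : ∀ b → ι b ≤ 1
ι≤1 true  = ≤-refl
ι≤1 false = z≤n

ι-∧-≤ˡ : ∀ a b → ι (a ∧ b) ≤ ι a
ι-∧-≤ˡ true  b = ι≤1 b
ι-∧-≤ˡ false b = z≤n

ι-pos : ∀ {b} → 0 < ι b → b ≡ true
ι-pos {true} _ = refl

ι-*-pos : ∀ b m → 0 < ι b * m → b ≡ true × 0 < m
ι-*-pos true m pos = refl , subst (0 <_) (+-identityʳ m) pos

ι-split : ∀ p s → ι p ≡ ι (p ∧ s) + ι (p ∧ not s)
ι-split true  true  = refl
ι-split true  false = refl
ι-split false s     = refl

ι-∧-∨-≤ : ∀ a p q → ι (a ∧ (p ∨ q)) ≤ ι (a ∧ p) + ι (a ∧ q)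
ι-∧-∨-≤ false p     q = z≤n
ι-∧-∨-≤ true  true  q = s≤s z≤n
ι-∧-∨-≤ true  false q = ≤-refl

ι-disjoint-≤ : ∀ a p q r x → (p ≡ true → q ≡ false) →
               ι (a ∧ p) + ι ((a ∧ (q ∧ r)) ∧ x) ≤ ι (p ∨ (q ∧ x)) * ι a
ι-disjoint-≤ false p     q     r     x     _    = ≤-reflexive (sym (*-zeroʳ (ι (p ∨ (q ∧ x)))))
ι-disjoint-≤ true  true  q     r     x     p⇒¬q rewrite p⇒¬q refl = ≤-refl
ι-disjoint-≤ true  false true  true  true  _    = ≤-refl
ι-disjoint-≤ true  false true  true  false _    = z≤n
ι-disjoint-≤ true  false true  false x     _    = z≤n
ι-disjoint-≤ true  false false r     x     _    = z≤n

≤ᵇ-true⇒≤ : ∀ {m k} → (m ≤ᵇ k) ≡ true → m ≤ k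
≤ᵇ-true⇒≤ {m} {k} eq = ≤ᵇ⇒≤ m k (subst T (sym eq) _)

≤ᵇ-false⇒> : ∀ {m k} → (m ≤ᵇ k) ≡ false → k < m
≤ᵇ-false⇒> eq = ≰⇒> λ m≤k → subst T eq (≤⇒≤ᵇ m≤k)

<ᵇ-true⇒< : ∀ {m k} → (m <ᵇ k) ≡ true → m < k
<ᵇ-true⇒< {m} {k} eq = <ᵇ⇒< m k (subst T (sym eq) _)

≡ᵇ-true⇒≡ : ∀ {m k} → (m ≡ᵇ k) ≡ true → m ≡ k
≡ᵇ-true⇒≡ {m} {k} eq = ≡ᵇ⇒≡ m k (subst T (sym eq) _)

-- Finite sums

sum-allFin : ∀ {n} (f : Fin n → ℕ) → List.sum (map f (allFin n)) ≡ ∑[ i < n ] f i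
sum-allFin f = trans (cong List.sum (map-tabulate id f)) (sum-tabulate f)
  where
  sum-tabulate : ∀ {n} (f : Fin n → ℕ) → List.sum (tabulate f) ≡ sum f
  sum-tabulate {zero}  f = refl
  sum-tabulate {suc n} f = cong (f zero +_) (sum-tabulate (f ∘ suc))

∑-mono-≤ : ∀ {n} {f g : Fin n → ℕ} → (∀ i → f i ≤ g i) → sum f ≤ sum g
∑-mono-≤ {zero}  f≤g = z≤n
∑-mono-≤ {suc n} f≤g = +-mono-≤ (f≤g zero) (∑-mono-≤ (f≤g ∘ suc))

∑-≤-const : ∀ {n} c {f : Fin n → ℕ} → (∀ i → f i ≤ c) → sum f ≤ n * c
∑-≤-const {zero}  c f≤c = z≤n
∑-≤-const {suc n} c f≤c = +-mono-≤ (f≤c zero) (∑-≤-const c (f≤c ∘ suc))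

∑-const : ∀ n c → ∑[ i < n ] c ≡ n * c
∑-const zero    c = refl
∑-const (suc n) c = cong (c +_) (∑-const n c)

∑-pos : ∀ {n} (f : Fin n → ℕ) → 0 < sum f → ∃ λ i → 0 < f i
∑-pos {suc n} f ∑f>0 with f zero in eq
... | suc _ = zero , subst (0 <_) (sym eq) z<s
... | zero with ∑-pos (f ∘ suc) ∑f>0
...   | i , fi>0 = suc i , fi>0

∑-agree-off : ∀ {n} {f g : Fin n → ℕ} k → (∀ i → i ≢ k → f i ≡ g i) →
              sum f + g k ≡ sum g + f k
∑-agree-off {suc n} {f} {g} k f≗g = begin
  sum f + g k                      ≡⟨ cong (_+ g k) (sum-remove {i = k} f) ⟩
  f k + sum (f ∘ punchIn k) + g k  ≡⟨ cong (λ s → f k + s + g k) (sum-cong-≗ λ i → f≗g _ (punchInᵢ≢i k i)) ⟩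
  f k + sum (g ∘ punchIn k) + g k  ≡⟨ xy∙z≈zy∙x (f k) (sum (g ∘ punchIn k)) (g k) ⟩
  g k + sum (g ∘ punchIn k) + f k  ≡⟨ cong (_+ f k) (sum-remove {i = k} g) ⟨
  sum g + f k                      ∎
  where open ≡-Reasoning

∑-pick : ∀ {L} c → c < L → (f : ℕ → ℕ) → ∑[ i < L ] (ι (c ≡ᵇ toℕ i) * f (toℕ i)) ≡ f c
∑-pick {suc L} zero    _   f = begin
  f 0 + 0 + ∑[ i < L ] 0  ≡⟨ cong (f 0 + 0 +_) (trans (∑-const L 0) (*-zeroʳ L)) ⟩
  f 0 + 0 + 0             ≡⟨ trans (+-identityʳ _) (+-identityʳ (f 0)) ⟩
  f 0                     ∎
  where open ≡-Reasoning
∑-pick {suc L} (suc c) c<L f = ∑-pick c (s≤s⁻¹ c<L) (f ∘ suc)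

-- ⌊log₂ k⌋, with lg 0 = 0.
lg : ℕ → ℕ
lg zero    = 0
lg (suc k) = if 2 ^ suc (lg k) ≤ᵇ suc k then suc (lg k) else lg k

<2^suc-lg : ∀ k → k < 2 ^ suc (lg k)
<2^suc-lg zero = s≤s z≤n
<2^suc-lg (suc k) with 2 ^ suc (lg k) ≤ᵇ suc k in eq
... | true  = begin-strict
  suc k                 ≤⟨ <2^suc-lg k ⟩
  2 ^ suc (lg k)        <⟨ m<m+n _ (+-monoˡ-< 0 (m^n>0 2 (suc (lg k)))) ⟩
  2 ^ suc (suc (lg k))  ∎
  where open ≤-Reasoning
... | false = ≤ᵇ-false⇒> eq

2^lg≤ : ∀ k → 1 ≤ k → 2 ^ lg k ≤ k
2^lg≤ (suc k) _ with 2 ^ suc (lg k) ≤ᵇ suc k in eq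
... | true  = ≤ᵇ-true⇒≤ eq
2^lg≤ (suc zero)    _ | false = ≤-refl
2^lg≤ (suc (suc k)) _ | false = m≤n⇒m≤1+n (2^lg≤ (suc k) (s≤s z≤n))

2^lg≤1+ : ∀ k → 2 ^ lg k ≤ suc k
2^lg≤1+ zero    = ≤-refl
2^lg≤1+ (suc k) = m≤n⇒m≤1+n (2^lg≤ (suc k) (s≤s z≤n))

lg-mono-≤ : ∀ {k m} → k ≤ m → lg k ≤ lg m
lg-mono-≤ {zero}      _   = z≤n
lg-mono-≤ {suc k} {m} k≤m = ≮⇒≥ λ lgm<lgk → <⇒≱ (<2^suc-lg m) (begin
  2 ^ suc (lg m)   ≤⟨ ^-monoʳ-≤ 2 lgm<lgk ⟩
  2 ^ lg (suc k)   ≤⟨ 2^lg≤ (suc k) (s≤s z≤n) ⟩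
  suc k            ≤⟨ k≤m ⟩
  m                ∎)
  where open ≤-Reasoning

VertexSet : ℕ → Set
VertexSet n = Fin n → Bool

_⊆_ : ∀ {n} → VertexSet n → VertexSet n → Set
X ⊆ Y = ∀ v → X v ≡ true → Y v ≡ true

infixl 7 _─_

_─_ : ∀ {n} → VertexSet n → Fin n → VertexSet n
(P ─ k) v = P v ∧ not (does (v Fin.≟ k))

─-self : ∀ {n} (P : VertexSet n) k → (P ─ k) k ≡ false
─-self P k rewrite dec-true (k Fin.≟ k) refl = Bool.∧-zeroʳ (P k)

─-other : ∀ {n} (P : VertexSet n) {k v} → v ≢ k → (P ─ k) v ≡ P v
─-other P {k} {v} v≢k rewrite dec-false (v Fin.≟ k) v≢k = Bool.∧-identityʳ (P v)

─-⊆ : ∀ {n} (P : VertexSet n) k → (P ─ k) ⊆ P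
─-⊆ P k v with P v
... | true  = λ _ → refl
... | false = λ ()

sumOver : ∀ {n} → VertexSet n → (Fin n → ℕ) → ℕ
sumOver {n} P g = ∑[ v < n ] (ι (P v) * g v)

syntax sumOver P (λ v → g) = ∑[ v ∈ P ] g

sumOver-─ : ∀ {n} (P : VertexSet n) (g : Fin n → ℕ) {k} → P k ≡ true →
            sumOver P g ≡ sumOver (P ─ k) g + g k
sumOver-─ P g {k} Pk = begin
  sumOver P g                        ≡⟨ +-identityʳ _ ⟨
  sumOver P g + 0                    ≡⟨ cong (λ b → sumOver P g + ι b * g k) (─-self P k) ⟨
  sumOver P g + ι ((P ─ k) k) * g k  ≡⟨ ∑-agree-off k (λ v v≢k → cong (λ b → ι b * g v) (sym (─-other P v≢k))) ⟩
  sumOver (P ─ k) g + ι (P k) * g k  ≡⟨ cong (λ b → sumOver (P ─ k) g + ι b * g k) Pk ⟩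
  sumOver (P ─ k) g + (g k + 0)      ≡⟨ cong (sumOver (P ─ k) g +_) (+-identityʳ (g k)) ⟩
  sumOver (P ─ k) g + g k            ∎
  where open ≡-Reasoning

∣_∣ : ∀ {n} → VertexSet n → ℕ
∣ P ∣ = ∑[ v ∈ P ] 1

∣─∣ : ∀ {n} (P : VertexSet n) {k} → P k ≡ true → ∣ P ∣ ≡ ∣ P ─ k ∣ + 1
∣─∣ P = sumOver-─ P (λ _ → 1)

∣─∣< : ∀ {n} (P : VertexSet n) {k} → P k ≡ true → ∣ P ─ k ∣ < ∣ P ∣
∣─∣< P Pk = ≤-reflexive (trans (+-comm 1 _) (sym (∣─∣ P Pk)))

∣∣≤ : ∀ {n} (P : VertexSet n) → ∣ P ∣ ≤ n
∣∣≤ {n} P = ≤-trans (∑-≤-const 1 λ v → ≤-trans (≤-reflexive (*-identityʳ (ι (P v)))) (ι≤1 (P v)))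
                    (≤-reflexive (*-identityʳ n))

*∣∣≤sumOver : ∀ {n} (P : VertexSet n) c (g : Fin n → ℕ) → (∀ v → P v ≡ true → c ≤ g v) →
              c * ∣ P ∣ ≤ sumOver P g
*∣∣≤sumOver P c g c≤g = begin
  c * ∣ P ∣                       ≡⟨ *-distribˡ-sum c (λ v → ι (P v) * 1) ⟩
  ∑[ v < _ ] (c * (ι (P v) * 1))  ≤⟨ ∑-mono-≤ pointwise ⟩
  sumOver P g                     ∎
  where
  open ≤-Reasoning
  pointwise : ∀ v → c * (ι (P v) * 1) ≤ ι (P v) * g v
  pointwise v with P v in Pv
  ... | true  = ≤-trans (≤-reflexive (*-identityʳ c)) (≤-trans (c≤g v Pv) (≤-reflexive (sym (+-identityʳ (g v)))))
  ... | false = ≤-reflexive (*-zeroʳ c)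

distinct⇒2≤ : ∀ {n} {u v : Fin n} → u ≢ v → 2 ≤ n
distinct⇒2≤ {suc zero}    {zero} {zero} u≢v = contradiction refl u≢v
distinct⇒2≤ {suc (suc n)} _                 = s≤s (s≤s z≤n)

-- Peeling to a dense core

module Counting {n} (A : Fin n → Fin n → Bool) (A-sym : ∀ u v → A u v ≡ A v u) where

  degIn : VertexSet n → Fin n → ℕ
  degIn Y v = ∑[ u ∈ Y ] ι (A v u)

  e : VertexSet n → VertexSet n → ℕ
  e X Y = ∑[ v ∈ X ] degIn Y v

  e-comm : ∀ X Y → e X Y ≡ e Y X
  e-comm X Y = begin
    ∑[ v < n ] (ι (X v) * ∑[ u < n ] (ι (Y u) * ι (A v u)))
      ≡⟨ sum-cong-≗ (λ v → *-distribˡ-sum (ι (X v)) (λ u → ι (Y u) * ι (A v u))) ⟩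
    ∑[ v < n ] ∑[ u < n ] (ι (X v) * (ι (Y u) * ι (A v u)))
      ≡⟨ ∑-comm (λ v u → ι (X v) * (ι (Y u) * ι (A v u))) ⟩
    ∑[ u < n ] ∑[ v < n ] (ι (X v) * (ι (Y u) * ι (A v u)))
      ≡⟨ sum-cong-≗ (λ u → sum-cong-≗ λ v → trans (x∙yz≈y∙xz (ι (X v)) (ι (Y u)) _)
                                                 (cong (λ b → ι (Y u) * (ι (X v) * ι b)) (A-sym v u))) ⟩
    ∑[ u < n ] ∑[ v < n ] (ι (Y u) * (ι (X v) * ι (A u v)))
      ≡⟨ sum-cong-≗ (λ u → *-distribˡ-sum (ι (Y u)) (λ v → ι (X v) * ι (A u v))) ⟨
    ∑[ u < n ] (ι (Y u) * ∑[ v < n ] (ι (X v) * ι (A u v)))  ∎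
    where open ≡-Reasoning

  e-─ˡ : ∀ X Y {k} → X k ≡ true → e X Y ≡ e (X ─ k) Y + degIn Y k
  e-─ˡ X Y = sumOver-─ X (degIn Y)

  e-─ʳ : ∀ X Y {k} → Y k ≡ true → e X Y ≡ e X (Y ─ k) + degIn X k
  e-─ʳ X Y {k} Yk = begin
    e X Y                    ≡⟨ e-comm X Y ⟩
    e Y X                    ≡⟨ e-─ˡ Y X Yk ⟩
    e (Y ─ k) X + degIn X k  ≡⟨ cong (_+ degIn X k) (e-comm (Y ─ k) X) ⟩
    e X (Y ─ k) + degIn X k  ∎
    where open ≡-Reasoning

  record DenseCore (X₀ Y₀ : VertexSet n) (M a b : ℕ) : Set where
    field
      X Y     : VertexSet n
      X⊆X₀    : X ⊆ X₀
      Y⊆Y₀    : Y ⊆ Y₀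
      e>0     : 0 < e X Y
      X-dense : ∀ x → X x ≡ true → a ≤ M * degIn Y x
      Y-dense : ∀ y → Y y ≡ true → b ≤ M * degIn X y

  module Peeling (X₀ Y₀ : VertexSet n) (M a b : ℕ) where

    cost : VertexSet n → VertexSet n → ℕ
    cost X Y = a * ∣ X ∣ + b * ∣ Y ∣

    record Peeled (X Y : VertexSet n) : Set where
      field
        X⊆X₀      : X ⊆ X₀
        Y⊆Y₀      : Y ⊆ Y₀
        potential : M * e X₀ Y₀ + cost X Y ≤ M * e X Y + cost X₀ Y₀

    -- Deleting a vertex of degree d with M * d ≤ r lowers M * e by at most r
    -- and the cost by exactly r.
    delete : ∀ {X Y X′ Y′ d r} → Peeled X Y → X′ ⊆ X → Y′ ⊆ Y →
             e X Y ≡ e X′ Y′ + d → cost X Y ≡ cost X′ Y′ + r → M * d ≤ r → Peeled X′ Y′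
    delete {X} {Y} {X′} {Y′} {d} {r} P X′⊆X Y′⊆Y e≡ cost≡ Md≤r = record
      { X⊆X₀      = λ v → X⊆X₀ v ∘ X′⊆X v
      ; Y⊆Y₀      = λ v → Y⊆Y₀ v ∘ Y′⊆Y v
      ; potential = +-cancelʳ-≤ r _ _ (begin
          M * e X₀ Y₀ + cost X′ Y′ + r      ≡⟨ +-assoc (M * e X₀ Y₀) (cost X′ Y′) r ⟩
          M * e X₀ Y₀ + (cost X′ Y′ + r)    ≡⟨ cong (M * e X₀ Y₀ +_) cost≡ ⟨
          M * e X₀ Y₀ + cost X Y            ≤⟨ potential ⟩
          M * e X Y + cost X₀ Y₀            ≡⟨ cong (λ t → M * t + cost X₀ Y₀) e≡ ⟩
          M * (e X′ Y′ + d) + cost X₀ Y₀    ≡⟨ cong (_+ cost X₀ Y₀) (*-distribˡ-+ M (e X′ Y′) d) ⟩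
          M * e X′ Y′ + M * d + cost X₀ Y₀  ≤⟨ +-monoˡ-≤ (cost X₀ Y₀) (+-monoʳ-≤ (M * e X′ Y′) Md≤r) ⟩
          M * e X′ Y′ + r + cost X₀ Y₀      ≡⟨ xy∙z≈xz∙y (M * e X′ Y′) r (cost X₀ Y₀) ⟩
          M * e X′ Y′ + cost X₀ Y₀ + r      ∎)
      }
      where
      open Peeled P
      open ≤-Reasoning

    cost-─ˡ : ∀ X Y {k} → X k ≡ true → cost X Y ≡ cost (X ─ k) Y + a
    cost-─ˡ X Y {k} Xk = trans (cong (λ s → a * s + b * ∣ Y ∣) (∣─∣ X Xk))
      (solve 4 (λ a x b y → a :* (x :+ con 1) :+ b :* y := a :* x :+ b :* y :+ a) refl a (∣ X ─ k ∣) b (∣ Y ∣))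

    cost-─ʳ : ∀ X Y {k} → Y k ≡ true → cost X Y ≡ cost X (Y ─ k) + b
    cost-─ʳ X Y {k} Yk = trans (cong (λ s → a * ∣ X ∣ + b * s) (∣─∣ Y Yk))
      (solve 4 (λ a x b y → a :* x :+ b :* (y :+ con 1) := a :* x :+ b :* y :+ b) refl a (∣ X ∣) b (∣ Y ─ k ∣))

    Stable : VertexSet n → VertexSet n → Set
    Stable X Y = (∀ x → X x ≡ true → a ≤ M * degIn Y x) × (∀ y → Y y ≡ true → b ≤ M * degIn X y)

    peel : ∀ X Y → Acc _<_ (∣ X ∣ + ∣ Y ∣) → Peeled X Y → ∃₂ λ X′ Y′ → Peeled X′ Y′ × Stable X′ Y′
    peel X Y (acc rec) P with any? (λ x → (X x Bool.≟ true) ×-dec (M * degIn Y x <? a))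
    ... | yes (k , Xk , low) =
      peel (X ─ k) Y (rec (+-monoˡ-< ∣ Y ∣ (∣─∣< X Xk)))
           (delete P (─-⊆ X k) (λ _ → id) (e-─ˡ X Y Xk) (cost-─ˡ X Y Xk) (<⇒≤ low))
    ... | no no-low-X with any? (λ y → (Y y Bool.≟ true) ×-dec (M * degIn X y <? b))
    ...   | yes (k , Yk , low) =
      peel X (Y ─ k) (rec (+-monoʳ-< ∣ X ∣ (∣─∣< Y Yk)))
           (delete P (λ _ → id) (─-⊆ Y k) (e-─ʳ X Y Yk) (cost-─ʳ X Y Yk) (<⇒≤ low))
    ...   | no no-low-Y = X , Y , P
                        , (λ x Xx → ≮⇒≥ λ low → no-low-X (x , Xx , low))
                        , (λ y Yy → ≮⇒≥ λ low → no-low-Y (y , Yy , low))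

    denseCore : cost X₀ Y₀ < M * e X₀ Y₀ → DenseCore X₀ Y₀ M a b
    denseCore gap with peel X₀ Y₀ (<-wellFounded _) (record { X⊆X₀ = λ _ → id ; Y⊆Y₀ = λ _ → id ; potential = ≤-refl })
    ... | X , Y , P , X-dense , Y-dense = record
      { X = X ; Y = Y ; X⊆X₀ = X⊆X₀ ; Y⊆Y₀ = Y⊆Y₀ ; e>0 = e>0 ; X-dense = X-dense ; Y-dense = Y-dense }
      where
      open Peeled P
      e>0 : 0 < e X Y
      e>0 = ≰⇒> λ e≤0 → <⇒≱ gap (begin
        M * e X₀ Y₀             ≤⟨ m≤m+n _ _ ⟩
        M * e X₀ Y₀ + cost X Y  ≤⟨ potential ⟩
        M * e X Y + cost X₀ Y₀  ≤⟨ +-monoˡ-≤ (cost X₀ Y₀) (*-monoʳ-≤ M e≤0) ⟩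
        M * 0 + cost X₀ Y₀      ≡⟨ cong (_+ cost X₀ Y₀) (*-zeroʳ M) ⟩
        cost X₀ Y₀              ∎)
        where open ≤-Reasoning

-- Bipartite subgraphs between disjoint vertex sets

degree≡∑ : ∀ {n} (a : Fin n → Fin n → Bool) v → degree a v ≡ ∑[ u < n ] ι (a v u)
degree≡∑ a v = sum-allFin (λ u → ι (a v u))

maxDegree-≤ : ∀ {n} (a : Fin n → Fin n → Bool) {c} → (∀ v → degree a v ≤ c) → maxDegree a ≤ c
maxDegree-≤ a {c} deg≤c = foldr-preservesᵇ {P = _≤ c} ⊔-lub z≤n (All.map⁺ (All.tabulate⁺ deg≤c))

module Between {n} (G : SimpleGraph n) (X Y : VertexSet n) (X∩Y≡∅ : ∀ v → X v ≡ true → Y v ≡ false) where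

  open Counting (adj G) (SimpleGraph.sym G)

  crossing : Fin n → Fin n → Bool
  crossing u v = adj G u v ∧ ((X u ∧ Y v) ∨ (Y u ∧ X v))

  crossing-sym : ∀ u v → crossing u v ≡ crossing v u
  crossing-sym u v = cong₂ _∧_ (SimpleGraph.sym G u v) (begin
    (X u ∧ Y v) ∨ (Y u ∧ X v)  ≡⟨ Bool.∨-comm (X u ∧ Y v) _ ⟩
    (Y u ∧ X v) ∨ (X u ∧ Y v)  ≡⟨ cong₂ _∨_ (Bool.∧-comm (Y u) (X v)) (Bool.∧-comm (X u) (Y v)) ⟩
    (X v ∧ Y u) ∨ (Y v ∧ X u)  ∎)
    where open ≡-Reasoning

  crossing-bip : ∀ u v → crossing u v ≡ true → (X u ≡ true × Y v ≡ true) ⊎ (Y u ≡ true × X v ≡ true)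
  crossing-bip u v uv = ∨-∧-true (X u) (Y v) (Y u) (X v) (Bool.∧-conicalʳ (adj G u v) _ uv)
    where
    ∨-∧-true : ∀ a b c d → (a ∧ b) ∨ (c ∧ d) ≡ true → (a ≡ true × b ≡ true) ⊎ (c ≡ true × d ≡ true)
    ∨-∧-true true  true  _     _     _  = inj₁ (refl , refl)
    ∨-∧-true true  false true  true  _  = inj₂ (refl , refl)
    ∨-∧-true false _     true  true  _  = inj₂ (refl , refl)
    ∨-∧-true true  false true  false ()
    ∨-∧-true true  false false _     ()
    ∨-∧-true false _     true  false ()
    ∨-∧-true false _     false _     ()

  between : BipartiteSubgraph G
  between = record
    { X = X ; Y = Y ; disjoint = X∩Y≡∅ ; edges = crossing ; e-sym = crossing-sym
    ; e-sub = λ u v uv → Bool.∧-conicalˡ _ _ uv ; e-bip = crossing-bip }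

  Y⇒¬X : ∀ {v} → Y v ≡ true → X v ≡ false
  Y⇒¬X {v} Yv with X v in Xv
  ... | false = refl
  ... | true  = trans (sym Yv) (X∩Y≡∅ v Xv)

  degree-X : ∀ {x} → X x ≡ true → degree crossing x ≡ degIn Y x
  degree-X {x} Xx = trans (degree≡∑ crossing x) (sum-cong-≗ λ u → begin
    ι (adj G x u ∧ ((X x ∧ Y u) ∨ (Y x ∧ X u)))
      ≡⟨ cong₂ (λ p q → ι (adj G x u ∧ ((p ∧ Y u) ∨ (q ∧ X u)))) Xx (X∩Y≡∅ x Xx) ⟩
    ι (adj G x u ∧ (Y u ∨ false))                ≡⟨ cong (λ b → ι (adj G x u ∧ b)) (Bool.∨-identityʳ (Y u)) ⟩
    ι (adj G x u ∧ Y u)                          ≡⟨ ι-∧-swap (adj G x u) (Y u) ⟩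
    ι (Y u) * ι (adj G x u)                      ∎)
    where open ≡-Reasoning

  degree-Y : ∀ {y} → Y y ≡ true → degree crossing y ≡ degIn X y
  degree-Y {y} Yy = trans (degree≡∑ crossing y) (sum-cong-≗ λ u → begin
    ι (adj G y u ∧ ((X y ∧ Y u) ∨ (Y y ∧ X u)))
      ≡⟨ cong₂ (λ p q → ι (adj G y u ∧ ((p ∧ Y u) ∨ (q ∧ X u)))) (Y⇒¬X Yy) Yy ⟩
    ι (adj G y u ∧ X u)                          ≡⟨ ι-∧-swap (adj G y u) (X u) ⟩
    ι (X u) * ι (adj G y u)                      ∎)
    where open ≡-Reasoning

  degree-outside : ∀ {v} → X v ≡ false → Y v ≡ false → degree crossing v ≡ 0
  degree-outside {v} Xv Yv = trans (degree≡∑ crossing v) (begin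
    ∑[ u < n ] ι (adj G v u ∧ ((X v ∧ Y u) ∨ (Y v ∧ X u)))
      ≡⟨ sum-cong-≗ (λ u → cong₂ (λ p q → ι (adj G v u ∧ ((p ∧ Y u) ∨ (q ∧ X u)))) Xv Yv) ⟩
    ∑[ u < n ] ι (adj G v u ∧ false)
      ≡⟨ sum-cong-≗ (λ u → cong ι (Bool.∧-zeroʳ (adj G v u))) ⟩
    ∑[ u < n ] 0
      ≡⟨ trans (∑-const n 0) (*-zeroʳ n) ⟩
    0  ∎)
    where open ≡-Reasoning

  degree-≤ : ∀ v → degree crossing v ≤ degree (adj G) v
  degree-≤ v = subst₂ _≤_ (sym (degree≡∑ crossing v)) (sym (degree≡∑ (adj G) v))
                          (∑-mono-≤ λ u → ι-∧-≤ˡ (adj G v u) _)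

  crossing-edge : 0 < e X Y → ∃ λ u → ∃ λ v → crossing u v ≡ true
  crossing-edge e>0 with ∑-pos _ e>0
  ... | u , pos-u with ι-*-pos (X u) _ pos-u
  ...   | Xu , degIn>0 with ∑-pos _ degIn>0
  ...     | v , pos-v with ι-*-pos (Y v) _ pos-v
  ...       | Yv , Auv>0 = u , v , (begin
    adj G u v ∧ ((X u ∧ Y v) ∨ (Y u ∧ X v))  ≡⟨ cong₂ (λ a p → a ∧ ((p ∧ Y v) ∨ (Y u ∧ X v))) (ι-pos Auv>0) Xu ⟩
    Y v ∨ (Y u ∧ X v)                        ≡⟨ cong (_∨ (Y u ∧ X v)) Yv ⟩
    true                                     ∎)
    where open ≡-Reasoning

-- Vertices are placed in index order; each joins the side holding at most
-- half of its already placed pre-neighbours.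
module GreedyCut {n} (pre : Fin n → Fin n → Bool)
                 (pre-earlier : ∀ u w → pre u w ≡ true → toℕ w < toℕ u) where

  choose : Fin n → VertexSet n → Bool
  choose u σ = ∑[ w < n ] ι (pre u w ∧ σ w) ≤ᵇ ∑[ w < n ] ι (pre u w ∧ not (σ w))

  sidesBelow : ℕ → VertexSet n
  sidesBelow zero    u = false
  sidesBelow (suc m) u = if does (toℕ u ≟ m) then choose u (sidesBelow m) else sidesBelow m u

  side : VertexSet n
  side u = choose u (sidesBelow (toℕ u))

  sidesBelow-stable : ∀ m w → toℕ w < m → sidesBelow m w ≡ side w
  sidesBelow-stable (suc m) w w<1+m with toℕ w ≟ m
  ... | yes refl rewrite dec-true (toℕ w ≟ toℕ w) refl = refl
  ... | no  w≢m  rewrite dec-false (toℕ w ≟ m) w≢m = sidesBelow-stable m w (≤∧≢⇒< (s≤s⁻¹ w<1+m) w≢m)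

  choose-cong : ∀ u {σ τ} → (∀ w → toℕ w < toℕ u → σ w ≡ τ w) → choose u σ ≡ choose u τ
  choose-cong u {σ} {τ} σ≈τ =
    cong₂ _≤ᵇ_ (sum-cong-≗ (agree σ τ σ≈τ))
               (sum-cong-≗ (agree (not ∘ σ) (not ∘ τ) λ w w<u → cong not (σ≈τ w w<u)))
    where
    agree : ∀ σ τ → (∀ w → toℕ w < toℕ u → σ w ≡ τ w) → ∀ w → ι (pre u w ∧ σ w) ≡ ι (pre u w ∧ τ w)
    agree σ τ σ≈τ w with pre u w in uw
    ... | true  = cong ι (σ≈τ w (pre-earlier u w uw))
    ... | false = refl

  side-unfold : ∀ u → side u ≡ choose u side
  side-unfold u = choose-cong u (sidesBelow-stable (toℕ u))

  opposite : Fin n → ℕ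
  opposite u = ∑[ w < n ] ι (pre u w ∧ (side u xor side w))

  cut : ∀ u → ∑[ w < n ] ι (pre u w) ≤ 2 * opposite u
  cut u = begin
    ∑[ w < n ] ι (pre u w)
      ≡⟨ sum-cong-≗ (λ w → ι-split (pre u w) (side w)) ⟩
    ∑[ w < n ] (ι (pre u w ∧ side w) + ι (pre u w ∧ not (side w)))
      ≡⟨ ∑-distrib-+ (λ w → ι (pre u w ∧ side w)) (λ w → ι (pre u w ∧ not (side w))) ⟩
    same + other
      ≤⟨ balanced (side u) refl ⟩
    2 * opposite u  ∎
    where
    open ≤-Reasoning
    same  = ∑[ w < n ] ι (pre u w ∧ side w)
    other = ∑[ w < n ] ι (pre u w ∧ not (side w))
    chosen : (same ≤ᵇ other) ≡ side u
    chosen = sym (side-unfold u)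
    balanced : ∀ s → side u ≡ s → same + other ≤ 2 * opposite u
    balanced true su rewrite su = begin
      same + other   ≤⟨ +-monoˡ-≤ other (≤ᵇ-true⇒≤ (trans chosen su)) ⟩
      other + other  ≡⟨ cong (other +_) (+-identityʳ other) ⟨
      2 * other      ∎
    balanced false su rewrite su = begin
      same + other   ≤⟨ +-monoʳ-≤ same (<⇒≤ (≤ᵇ-false⇒> (trans chosen su))) ⟩
      same + same    ≡⟨ cong (same +_) (+-identityʳ same) ⟨
      2 * same       ∎

module Orientation {n} (A : Fin n → Fin n → Bool) (A-sym : ∀ u v → A u v ≡ A v u) (A-irr : ∀ v → A v v ≡ false)
                   (_≺_ : Fin n → Fin n → Bool) (≺-tournament : ∀ u v → u ≢ v → ι (u ≺ v) + ι (v ≺ u) ≡ 1) where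

  down : Fin n → ℕ
  down v = ∑[ u < n ] ι (A v u ∧ (u ≺ v))

  edge-oriented : ∀ v u → ι (A v u) ≡ ι (A v u ∧ (u ≺ v)) + ι (A u v ∧ (v ≺ u))
  edge-oriented v u with A v u in vu | A u v in uv
  ... | false | false = refl
  ... | false | true  = contradiction (trans (sym uv) (trans (A-sym u v) vu)) λ ()
  ... | true  | false = contradiction (trans (sym vu) (trans (A-sym v u) uv)) λ ()
  ... | true  | true  = sym (≺-tournament u v u≢v)
    where
    u≢v : u ≢ v
    u≢v refl = contradiction (trans (sym vu) (A-irr u)) λ ()

  handshake : ∑[ v < n ] ∑[ u < n ] ι (A v u) ≡ 2 * ∑[ v < n ] down v
  handshake = begin
    ∑[ v < n ] ∑[ u < n ] ι (A v u)
      ≡⟨ sum-cong-≗ (λ v → trans (sum-cong-≗ (edge-oriented v)) (∑-distrib-+ (λ u → ι (A v u ∧ (u ≺ v))) _)) ⟩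
    ∑[ v < n ] (down v + ∑[ u < n ] ι (A u v ∧ (v ≺ u)))
      ≡⟨ ∑-distrib-+ down _ ⟩
    ∑[ v < n ] down v + ∑[ v < n ] ∑[ u < n ] ι (A u v ∧ (v ≺ u))
      ≡⟨ cong (∑[ v < n ] down v +_) (∑-comm (λ v u → ι (A u v ∧ (v ≺ u)))) ⟩
    ∑[ v < n ] down v + ∑[ u < n ] down u
      ≡⟨ cong (∑[ v < n ] down v +_) (+-identityʳ _) ⟨
    2 * ∑[ v < n ] down v  ∎
    where open ≡-Reasoning

lex< : ℕ → ℕ → ℕ → ℕ → Bool
lex< c t d w = (c <ᵇ d) ∨ ((c ≡ᵇ d) ∧ (t <ᵇ w))

lex<-tournament : ∀ c t d w → t ≢ w → ι (lex< c t d w) + ι (lex< d w c t) ≡ 1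
lex<-tournament c t d w t≢w with <-cmp c d
... | tri< c<d c≢d _
  rewrite dec-true (c <? d) c<d | dec-false (d <? c) (<⇒≯ c<d) | dec-false (d ≟ c) (c≢d ∘ sym) = refl
... | tri> _ c≢d d<c
  rewrite dec-false (c <? d) (<⇒≯ d<c) | dec-true (d <? c) d<c | dec-false (c ≟ d) c≢d = refl
... | tri≈ _ refl _ rewrite dec-false (c <? c) (<-irrefl refl) | dec-true (c ≟ c) refl with <-cmp t w
...   | tri< t<w _ _ rewrite dec-true (t <? w) t<w | dec-false (w <? t) (<⇒≯ t<w) = refl
...   | tri≈ _ t≡w _ = contradiction t≡w t≢w
...   | tri> _ _ w<t rewrite dec-false (t <? w) (<⇒≯ w<t) | dec-true (w <? t) w<t = refl

-- Degree classes and options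

module Classes {n} (G : SimpleGraph n) where

  A : Fin n → Fin n → Bool
  A = adj G

  open Counting A (SimpleGraph.sym G) public

  deg : Fin n → ℕ
  deg v = ∑[ u < n ] ι (A v u)

  D : ℕ
  D = ∑[ v < n ] deg v

  degSum≡D : degSum A ≡ D
  degSum≡D = trans (sum-allFin (degree A)) (sum-cong-≗ (degree≡∑ A))

  deg≤n : ∀ v → deg v ≤ n
  deg≤n v = ≤-trans (∑-≤-const 1 (λ u → ι≤1 (A v u))) (≤-reflexive (*-identityʳ n))

  cls : Fin n → ℕ
  cls v = lg (deg v)

  ℓ : ℕ
  ℓ = lg n

  cls≤ℓ : ∀ v → cls v ≤ ℓ
  cls≤ℓ v = lg-mono-≤ (deg≤n v)

  _≺_ : Fin n → Fin n → Bool
  u ≺ v = lex< (cls u) (toℕ u) (cls v) (toℕ v)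

  open Orientation A (SimpleGraph.sym G) (SimpleGraph.irrfl G) _≺_
                   (λ u v u≢v → lex<-tournament (cls u) (toℕ u) (cls v) (toℕ v) (u≢v ∘ toℕ-injective)) public

  pre : Fin n → Fin n → Bool
  pre v u = A v u ∧ ((cls u ≡ᵇ cls v) ∧ (toℕ u <ᵇ toℕ v))

  pre-earlier : ∀ v u → pre v u ≡ true → toℕ u < toℕ v
  pre-earlier v u vu = <ᵇ-true⇒< (Bool.∧-conicalʳ (cls u ≡ᵇ cls v) _ (Bool.∧-conicalʳ (A v u) _ vu))

  open GreedyCut pre pre-earlier public

  Xᵒ : ℕ → Bool → VertexSet n
  Xᵒ i s v = (cls v ≡ᵇ i) ∧ not (s xor side v)

  Yᵒ : ℕ → Bool → VertexSet n
  Yᵒ i s u = (cls u <ᵇ i) ∨ ((cls u ≡ᵇ i) ∧ (s xor side u))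

  Xᵒ-cls : ∀ {i s v} → Xᵒ i s v ≡ true → cls v ≡ i
  Xᵒ-cls h = ≡ᵇ-true⇒≡ (Bool.∧-conicalˡ _ _ h)

  Xᵒ-side : ∀ {i s v} → Xᵒ i s v ≡ true → side v ≡ s
  Xᵒ-side {i} {s} {v} h = same-side s (side v) (Bool.∧-conicalʳ (cls v ≡ᵇ i) _ h)
    where
    same-side : ∀ s t → not (s xor t) ≡ true → t ≡ s
    same-side true  true  _ = refl
    same-side false false _ = refl

  Yᵒ-cls : ∀ {i s v} → Yᵒ i s v ≡ true → cls v ≤ i
  Yᵒ-cls {i} {s} {v} h with cls v <ᵇ i in lt
  ... | true  = <⇒≤ (<ᵇ-true⇒< lt)
  ... | false = ≤-reflexive (≡ᵇ-true⇒≡ (Bool.∧-conicalˡ _ _ h))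

  Xᵒ∩Yᵒ≡∅ : ∀ i s v → Xᵒ i s v ≡ true → Yᵒ i s v ≡ false
  Xᵒ∩Yᵒ≡∅ i s v h = begin
    (cls v <ᵇ i) ∨ ((cls v ≡ᵇ i) ∧ (s xor side v))
      ≡⟨ cong₂ (λ c t → (c <ᵇ i) ∨ ((c ≡ᵇ i) ∧ (s xor t))) (Xᵒ-cls {s = s} h) (Xᵒ-side h) ⟩
    (i <ᵇ i) ∨ ((i ≡ᵇ i) ∧ (s xor s))
      ≡⟨ cong₂ (λ p q → p ∨ ((i ≡ᵇ i) ∧ q)) (dec-false (i <? i) (<-irrefl refl)) (Bool.xor-same s) ⟩
    (i ≡ᵇ i) ∧ false
      ≡⟨ Bool.∧-zeroʳ (i ≡ᵇ i) ⟩
    false  ∎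
    where open ≡-Reasoning

  down≤2degIn : ∀ v → down v ≤ 2 * degIn (Yᵒ (cls v) (side v)) v
  down≤2degIn v = begin
    down v
      ≤⟨ ∑-mono-≤ (λ u → ι-∧-∨-≤ (A v u) (lower u) _) ⟩
    ∑[ u < n ] (ι (A v u ∧ lower u) + ι (pre v u))
      ≡⟨ ∑-distrib-+ (λ u → ι (A v u ∧ lower u)) (λ u → ι (pre v u)) ⟩
    below + ∑[ u < n ] ι (pre v u)
      ≤⟨ +-mono-≤ (m≤m+n below below) (cut v) ⟩
    (below + below) + 2 * opposite v
      ≡⟨ cong (λ t → t + 2 * opposite v) (cong (below +_) (+-identityʳ below)) ⟨
    2 * below + 2 * opposite v
      ≡⟨ *-distribˡ-+ 2 below (opposite v) ⟨
    2 * (below + opposite v)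
      ≡⟨ cong (2 *_) (∑-distrib-+ (λ u → ι (A v u ∧ lower u)) _) ⟨
    2 * ∑[ u < n ] (ι (A v u ∧ lower u) + ι (pre v u ∧ (side v xor side u)))
      ≤⟨ *-monoʳ-≤ 2 (∑-mono-≤ λ u → ι-disjoint-≤ (A v u) (lower u) _ _ _ (lower⇒≢ u)) ⟩
    2 * degIn (Yᵒ (cls v) (side v)) v  ∎
    where
    open ≤-Reasoning
    lower : Fin n → Bool
    lower u = cls u <ᵇ cls v
    below : ℕ
    below = ∑[ u < n ] ι (A v u ∧ lower u)
    lower⇒≢ : ∀ u → lower u ≡ true → (cls u ≡ᵇ cls v) ≡ false
    lower⇒≢ u lt = dec-false (cls u ≟ cls v) λ eq → <-irrefl eq (<ᵇ-true⇒< lt)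

  L : ℕ
  L = suc ℓ

  ∑ᵒ : (ℕ → Bool → ℕ) → ℕ
  ∑ᵒ F = ∑[ i < L ] (F (toℕ i) true + F (toℕ i) false)

  ∑ᵒ-mono-≤ : ∀ {F G : ℕ → Bool → ℕ} → (∀ (i : Fin L) s → F (toℕ i) s ≤ G (toℕ i) s) → ∑ᵒ F ≤ ∑ᵒ G
  ∑ᵒ-mono-≤ F≤G = ∑-mono-≤ {L} λ i → +-mono-≤ (F≤G i true) (F≤G i false)

  ∑ᵒ-distrib-+ : ∀ (F G : ℕ → Bool → ℕ) → ∑ᵒ (λ i s → F i s + G i s) ≡ ∑ᵒ F + ∑ᵒ G
  ∑ᵒ-distrib-+ F G =
    trans (sum-cong-≗ {L} λ i → interchange (F (toℕ i) true) (G (toℕ i) true) (F (toℕ i) false) (G (toℕ i) false))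
          (∑-distrib-+ {L} (λ i → F (toℕ i) true + F (toℕ i) false) (λ i → G (toℕ i) true + G (toℕ i) false))

  *-distribˡ-∑ᵒ : ∀ c (F : ℕ → Bool → ℕ) → c * ∑ᵒ F ≡ ∑ᵒ (λ i s → c * F i s)
  *-distribˡ-∑ᵒ c F = trans (*-distribˡ-sum {L} c (λ i → F (toℕ i) true + F (toℕ i) false))
                            (sum-cong-≗ {L} λ i → *-distribˡ-+ c (F (toℕ i) true) (F (toℕ i) false))

  ∑ᵒ-const : ∀ c → ∑ᵒ (λ _ _ → c) ≡ L * (c + c)
  ∑ᵒ-const c = ∑-const L (c + c)

  option-split : ∀ v i (h : Bool → ℕ) →
                 ι (Xᵒ i true v) * h true + ι (Xᵒ i false v) * h false ≡ ι (cls v ≡ᵇ i) * h (side v)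
  option-split v i h with cls v ≡ᵇ i
  ... | false = refl
  ... | true with side v
  ...   | true  = +-identityʳ (h true + 0)
  ...   | false = refl

  ∑ᵒ-partition : ∀ (h : ℕ → Bool → Fin n → ℕ) →
                 ∑ᵒ (λ i s → ∑[ v ∈ Xᵒ i s ] h i s v) ≡ ∑[ v < n ] h (cls v) (side v) v
  ∑ᵒ-partition h = begin
    ∑[ i < L ] (∑[ v < n ] term i true v + ∑[ v < n ] term i false v)
      ≡⟨ sum-cong-≗ {L} (λ i → ∑-distrib-+ (term i true) (term i false)) ⟨
    ∑[ i < L ] ∑[ v < n ] (term i true v + term i false v)
      ≡⟨ ∑-comm (λ i v → term i true v + term i false v) ⟩
    ∑[ v < n ] ∑[ i < L ] (term i true v + term i false v)
      ≡⟨ sum-cong-≗ (λ v → sum-cong-≗ {L} λ i → option-split v (toℕ i) (λ s → h (toℕ i) s v)) ⟩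
    ∑[ v < n ] ∑[ i < L ] (ι (cls v ≡ᵇ toℕ i) * h (toℕ i) (side v) v)
      ≡⟨ sum-cong-≗ (λ v → ∑-pick {L} (cls v) (s≤s (cls≤ℓ v)) (λ i → h i (side v) v)) ⟩
    ∑[ v < n ] h (cls v) (side v) v  ∎
    where
    open ≡-Reasoning
    term : Fin L → Bool → Fin n → ℕ
    term i s v = ι (Xᵒ (toℕ i) s v) * h (toℕ i) s v

  eᵒ : ℕ → Bool → ℕ
  eᵒ i s = e (Xᵒ i s) (Yᵒ i s)

  D≤4∑ᵒe : D ≤ 4 * ∑ᵒ eᵒ
  D≤4∑ᵒe = begin
    D                                   ≡⟨ handshake ⟩
    2 * ∑[ v < n ] down v               ≤⟨ *-monoʳ-≤ 2 (∑-mono-≤ down≤2degIn) ⟩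
    2 * ∑[ v < n ] (2 * counted v)      ≡⟨ cong (2 *_) (*-distribˡ-sum 2 counted) ⟨
    2 * (2 * ∑[ v < n ] counted v)      ≡⟨ *-assoc 2 2 (∑[ v < n ] counted v) ⟨
    4 * ∑[ v < n ] counted v            ≡⟨ cong (4 *_) (∑ᵒ-partition (λ i s → degIn (Yᵒ i s))) ⟨
    4 * ∑ᵒ eᵒ                           ∎
    where
    open ≤-Reasoning
    counted : Fin n → ℕ
    counted v = degIn (Yᵒ (cls v) (side v)) v

-- Once 2n is replaced by 2D (n ≤ D), the two sides differ by (1600 (ℓ - 1) + 320) n D.
budget : ∀ ℓ n D → 1 ≤ ℓ → n ≤ D → 1 ≤ n * D →
         4 * (ℓ * (20 * n) * (2 * D + 2 * n) + suc ℓ * (160 * D * n + 160 * D * n)) < ℓ * (20 * n) * 160 * D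
budget (suc l) n D _ n≤D nD≥1 = begin-strict
  4 * (K * (2 * D + 2 * n) + suc (suc l) * (b * n + b * n))
    ≤⟨ *-monoʳ-≤ 4 (+-monoˡ-≤ _ (*-monoʳ-≤ K (+-monoʳ-≤ (2 * D) (*-monoʳ-≤ 2 n≤D)))) ⟩
  R
    <⟨ m<m+n R (*-mono-≤ (≤-trans (s≤s z≤n) (m≤n+m 320 (1600 * l))) nD≥1) ⟩
  R + (1600 * l + 320) * (n * D)
    ≡⟨ solve 3 (λ l n D → con 4 :* ((con 1 :+ l) :* (con 20 :* n) :* (con 2 :* D :+ con 2 :* D)
                              :+ (con 2 :+ l) :* (con 160 :* D :* n :+ con 160 :* D :* n))
                          :+ (con 1600 :* l :+ con 320) :* (n :* D)
                          := (con 1 :+ l) :* (con 20 :* n) :* con 160 :* D) refl l n D ⟩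
  K * 160 * D  ∎
  where
  open ≤-Reasoning
  K = suc l * (20 * n)
  b = 160 * D
  R = 4 * (K * (2 * D + 2 * D) + suc (suc l) * (b * n + b * n))

module HeavyOption {n} (G : SimpleGraph n) (n≥1 : 1 ≤ n) (n≤degSum : n ≤ degSum (adj G)) where

  open Classes G

  n≤D : n ≤ D
  n≤D = subst (n ≤_) degSum≡D n≤degSum

  ℓ≥1 : 1 ≤ ℓ
  ℓ≥1 with ∑-pos deg (≤-trans n≥1 n≤D)
  ... | v , deg>0 with ∑-pos (λ u → ι (A v u)) deg>0
  ...   | u , Avu>0 = lg-mono-≤ (distinct⇒2≤ v≢u)
    where
    v≢u : v ≢ u
    v≢u refl = contradiction (trans (sym (ι-pos Avu>0)) (SimpleGraph.irrfl G v)) λ ()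

  -- The peeling thresholds a i / M = 2^(i+1) / 160 and b / M = D / K are
  -- the two degree bounds of the conclusion.
  K M b : ℕ
  K = ℓ * (20 * n)
  M = K * 160
  b = 160 * D

  a : ℕ → ℕ
  a i = K * 2 ^ suc i

  cost : ℕ → Bool → ℕ
  cost i s = a i * ∣ Xᵒ i s ∣ + b * ∣ Yᵒ i s ∣

  Light Heavy : ℕ → Bool → Set
  Light i s = M * eᵒ i s ≤ cost i s
  Heavy i s = cost i s < M * eᵒ i s

  weight : Fin n → ℕ
  weight v = K * (2 * deg v + 2)

  cost≤ : ∀ i s → cost i s ≤ ∑[ v ∈ Xᵒ i s ] weight v + b * n
  cost≤ i s = +-mono-≤ (*∣∣≤sumOver (Xᵒ i s) (a i) _ a≤) (*-monoʳ-≤ b (∣∣≤ (Yᵒ i s)))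
    where
    a≤ : ∀ v → Xᵒ i s v ≡ true → a i ≤ weight v
    a≤ v Xv = *-monoʳ-≤ K (begin
      2 * 2 ^ i            ≡⟨ cong (λ c → 2 * 2 ^ c) (Xᵒ-cls {s = s} Xv) ⟨
      2 * 2 ^ cls v        ≤⟨ *-monoʳ-≤ 2 (2^lg≤1+ (deg v)) ⟩
      2 * suc (deg v)      ≡⟨ trans (*-suc 2 (deg v)) (+-comm 2 (2 * deg v)) ⟩
      2 * deg v + 2        ∎)
      where open ≤-Reasoning

  ∑-weight : ∑[ v < n ] weight v ≡ K * (2 * D + 2 * n)
  ∑-weight = begin
    ∑[ v < n ] (K * (2 * deg v + 2))           ≡⟨ *-distribˡ-sum K (λ v → 2 * deg v + 2) ⟨
    K * ∑[ v < n ] (2 * deg v + 2)             ≡⟨ cong (K *_) (∑-distrib-+ (λ v → 2 * deg v) (λ _ → 2)) ⟩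
    K * (∑[ v < n ] (2 * deg v) + ∑[ v < n ] 2)
      ≡⟨ cong₂ (λ p q → K * (p + q)) (sym (*-distribˡ-sum 2 deg)) (trans (∑-const n 2) (*-comm n 2)) ⟩
    K * (2 * D + 2 * n)                        ∎
    where open ≡-Reasoning

  ∑ᵒcost≤ : ∑ᵒ cost ≤ K * (2 * D + 2 * n) + L * (b * n + b * n)
  ∑ᵒcost≤ = begin
    ∑ᵒ cost
      ≤⟨ ∑ᵒ-mono-≤ {F = cost} {G = λ i s → ∑[ v ∈ Xᵒ i s ] weight v + b * n} (λ i s → cost≤ (toℕ i) s) ⟩
    ∑ᵒ (λ i s → ∑[ v ∈ Xᵒ i s ] weight v + b * n)
      ≡⟨ ∑ᵒ-distrib-+ (λ i s → ∑[ v ∈ Xᵒ i s ] weight v) (λ _ _ → b * n) ⟩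
    ∑ᵒ (λ i s → ∑[ v ∈ Xᵒ i s ] weight v) + ∑ᵒ (λ _ _ → b * n)
      ≡⟨ cong₂ _+_ (trans (∑ᵒ-partition (λ _ _ → weight)) ∑-weight) (∑ᵒ-const (b * n)) ⟩
    K * (2 * D + 2 * n) + L * (b * n + b * n)  ∎
    where open ≤-Reasoning

  not-all-light : ¬ (∀ (i : Fin L) s → Light (toℕ i) s)
  not-all-light light = <⇒≱ (budget ℓ n D ℓ≥1 n≤D (*-mono-≤ n≥1 (≤-trans n≥1 n≤D))) (begin
    M * D                               ≤⟨ *-monoʳ-≤ M D≤4∑ᵒe ⟩
    M * (4 * ∑ᵒ eᵒ)                     ≡⟨ x∙yz≈y∙xz M 4 (∑ᵒ eᵒ) ⟩
    4 * (M * ∑ᵒ eᵒ)                     ≡⟨ cong (4 *_) (*-distribˡ-∑ᵒ M eᵒ) ⟩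
    4 * ∑ᵒ (λ i s → M * eᵒ i s)         ≤⟨ *-monoʳ-≤ 4 (∑ᵒ-mono-≤ {F = λ i s → M * eᵒ i s} {G = cost} light) ⟩
    4 * ∑ᵒ cost                         ≤⟨ *-monoʳ-≤ 4 ∑ᵒcost≤ ⟩
    4 * (K * (2 * D + 2 * n) + L * (b * n + b * n)) ∎)
    where open ≤-Reasoning

  light? : ∀ i s → Dec (Light i s)
  light? i s = M * eᵒ i s ≤? cost i s

  heavy-side : ∀ i → Dec (Light i true) → ¬ (Light i true × Light i false) → ∃ (Heavy i)
  heavy-side i (no ¬light) _        = true , ≰⇒> ¬light
  heavy-side i (yes light) not-both = false , ≰⇒> λ light′ → not-both (light , light′)

  heavy-option : ∃₂ Heavy
  heavy-option = heavy-row (¬∀⟶∃¬ L (λ i → Light (toℕ i) true × Light (toℕ i) false)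
                                     (λ i → light? (toℕ i) true ×-dec light? (toℕ i) false)
                                     (λ light → not-all-light λ i → both-sides (proj₁ (light i)) (proj₂ (light i))))
    where
    both-sides : ∀ {P : Bool → Set} → P true → P false → ∀ s → P s
    both-sides pt pf true  = pt
    both-sides pt pf false = pf
    heavy-row : (∃ λ (i : Fin L) → ¬ (Light (toℕ i) true × Light (toℕ i) false)) → ∃₂ Heavy
    heavy-row (i , not-both) = toℕ i , heavy-side (toℕ i) (light? (toℕ i) true) not-both

  K>0 : 0 < K
  K>0 = ≤-trans (s≤s z≤n) (*-mono-≤ ℓ≥1 (*-monoʳ-≤ 20 n≥1))

  deg≤2^ : ∀ {v i} → cls v ≤ i → degree A v ≤ 2 ^ suc i
  deg≤2^ {v} cls≤i = ≤-trans (≤-reflexive (degree≡∑ A v))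
                             (<⇒≤ (<-≤-trans (<2^suc-lg (deg v)) (^-monoʳ-≤ 2 (s≤s cls≤i))))

  module Core (i : ℕ) (s : Bool) (heavy : Heavy i s) where

    open DenseCore (Peeling.denseCore (Xᵒ i s) (Yᵒ i s) M (a i) b heavy) public

    X∩Y≡∅ : ∀ v → X v ≡ true → Y v ≡ false
    X∩Y≡∅ v Xv with Y v in Yv
    ... | false = refl
    ... | true  = trans (sym (Y⊆Y₀ v Yv)) (Xᵒ∩Yᵒ≡∅ i s v (X⊆X₀ v Xv))

    open Between G X Y X∩Y≡∅ public

    degree≤2^ : ∀ v → degree crossing v ≤ 2 ^ suc i
    degree≤2^ v = by-membership (X v) (Y v) refl refl
      where
      by-membership : ∀ x y → X v ≡ x → Y v ≡ y → degree crossing v ≤ 2 ^ suc i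
      by-membership true  _     Xv _  = ≤-trans (degree-≤ v) (deg≤2^ (≤-reflexive (Xᵒ-cls {s = s} (X⊆X₀ v Xv))))
      by-membership false true  _  Yv = ≤-trans (degree-≤ v) (deg≤2^ (Yᵒ-cls {s = s} (Y⊆Y₀ v Yv)))
      by-membership false false Xv Yv = subst (_≤ 2 ^ suc i) (sym (degree-outside Xv Yv)) z≤n

    X-balanced : ∀ x → X x ≡ true → maxDegree crossing ≤ 160 * degree crossing x
    X-balanced x Xx = begin
      maxDegree crossing          ≤⟨ maxDegree-≤ crossing degree≤2^ ⟩
      2 ^ suc i                   ≤⟨ *-cancelˡ-≤ K {{>-nonZero K>0}} (subst (a i ≤_) (*-assoc K 160 _) (X-dense x Xx)) ⟩
      160 * degIn Y x             ≡⟨ cong (160 *_) (degree-X Xx) ⟨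
      160 * degree crossing x     ∎
      where open ≤-Reasoning

    Y-heavy : ∀ y → Y y ≡ true → 2 ^ degSum A ≤ n ^ (20 * n * degree crossing y)
    Y-heavy y Yy = begin
      2 ^ degSum A                 ≡⟨ cong (2 ^_) degSum≡D ⟩
      2 ^ D                        ≤⟨ ^-monoʳ-≤ 2 D≤Kk ⟩
      2 ^ (ℓ * (20 * n) * k)       ≡⟨ cong (2 ^_) (*-assoc ℓ (20 * n) k) ⟩
      2 ^ (ℓ * (20 * n * k))       ≡⟨ ^-*-assoc 2 ℓ (20 * n * k) ⟨
      (2 ^ ℓ) ^ (20 * n * k)       ≤⟨ ^-monoˡ-≤ (20 * n * k) (2^lg≤ n n≥1) ⟩
      n ^ (20 * n * k)             ≡⟨ cong (λ d → n ^ (20 * n * d)) (degree-Y Yy) ⟨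
      n ^ (20 * n * degree crossing y)  ∎
      where
      open ≤-Reasoning
      k = degIn X y
      D≤Kk : D ≤ K * k
      D≤Kk = *-cancelˡ-≤ 160 (subst (b ≤_) (xy∙z≈y∙xz K 160 k) (Y-dense y Yy))

  Conclusion : Set
  Conclusion =
    Σ (BipartiteSubgraph G) λ H →
      (∃ λ (u : Fin n) → ∃ λ (v : Fin n) → BipartiteSubgraph.edges H u v ≡ true)
      × (∀ x → BipartiteSubgraph.X H x ≡ true →
           maxDegree (BipartiteSubgraph.edges H) ≤ 160 * degree (BipartiteSubgraph.edges H) x)
      × (∀ y → BipartiteSubgraph.Y H y ≡ true →
           2 ^ degSum (adj G) ≤ n ^ (20 * n * degree (BipartiteSubgraph.edges H) y))

  from-heavy : ∃₂ Heavy → Conclusion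
  from-heavy (i , s , heavy) = between , crossing-edge e>0 , X-balanced , Y-heavy
    where open Core i s heavy

  bipartite-subgraph : Conclusion
  bipartite-subgraph = from-heavy heavy-option

lemma4p3 : ∃ λ (d₀ : ℕ) → ∀ (n : ℕ) (G : SimpleGraph n) → 1 ≤ n →
    d₀ * n ≤ degSum (adj G) →
    Σ (BipartiteSubgraph G) λ H →
      (∃ λ (i : Fin n) → ∃ λ (j : Fin n) → BipartiteSubgraph.edges H i j ≡ true)
      × (∀ x → BipartiteSubgraph.X H x ≡ true →
           maxDegree (BipartiteSubgraph.edges H) ≤ 160 * degree (BipartiteSubgraph.edges H) x)
      × (∀ y → BipartiteSubgraph.Y H y ≡ true →
           2 ^ degSum (adj G) ≤ n ^ (20 * n * degree (BipartiteSubgraph.edges H) y))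
lemma4p3 = 1 , λ n G n≥1 n≤degSum →
  HeavyOption.bipartite-subgraph G n≥1 (subst (_≤ degSum (adj G)) (*-identityˡ n) n≤degSum)
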